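{- Let $\mathcal{G}=(G_1,\dots,G_r)$ be a sequence of graphs on a common vertex set $V$ with $|V|=n$, and let $\epsilon>0$. Consider the algorithm MDS-IP, which runs as follows. 1. It starts with the interval $L=0$ and $U=\frac{n-1}{2}$. 2. It performs a binary search. At each step it takes the midpoint $\gamma=(L+U)/2$ and solves $\mathrm{MDS}(\gamma)$ exactly. If the optimal solution is nonempty it sets $L=\gamma$; otherwise it sets $U=\gamma$. 3. It stops once $|U-L|\le\epsilon L$ and returns an optimal solution $S$ of $\mathrm{MDS}(L)$. Here $\mathrm{MDS}(\gamma)$ is the problem: maximize $\min_i m(S,G_i)-\gamma|S|$ over $S\subseteq V$. Let $\gamma=\min_i d(S,G_i)$ be the score of the returned solution. Let $\gamma^*$ be the optimal value of MDS, i.e. the maximum of $\min_i d(S,G_i)$ over nonempty $S\subseteq V$. Then $\gamma\ge\gamma^*/(1+\epsilon)$. Moreover, if $\epsilon\le\frac{1}{n^3}$, then $\gamma=\gamma^*$.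
   Context: Each $G_i=(V,E_i)$ is a simple undirected graph. For $S\subseteq V$, $m(S,G_i)$ is the number of edges of $E_i$ with both endpoints in $S$. For nonempty $S$, the density is $d(S,G_i)=m(S,G_i)/|S|$. -}

module Defs where

open import Data.Bool using (Bool; true; false; if_then_else_; _∧_)
open import Data.Nat as ℕ using (ℕ; zero; suc; _<ᵇ_; _∸_)
open import Data.Fin using (Fin; toℕ)
open import Data.List using (List; map; allFin)
open import Data.Nat.ListAction using (sum)
open import Data.Vec using (lookup)
open import Data.Product using (_×_; _,_; ∃; proj₁; proj₂)
open import Data.Integer using (+_)
open import Data.Rational using (ℚ; 0ℚ; _+_; _-_; _*_; _⊓_; _≤_; ½) renaming (∣_∣ to absℚ)
import Data.Rational as ℚ
open import Data.Fin.Subset using (Subset; ∣_∣; Nonempty)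
open import Data.Fin.Subset.Properties using (nonempty?)
open import Relation.Nullary using (does)
open import Relation.Binary.PropositionalEquality using (_≡_)

record Graph (n : ℕ) : Set where
  field
    adj   : Fin n → Fin n → Bool
    sym   : ∀ u v → adj u v ≡ adj v u
    irrefl : ∀ u → adj u u ≡ false
open Graph public

-- m(S,G): number of edges {u,v} (counted once, via toℕ u < toℕ v) with both ends in S.
edgesIn : ∀ {n} → Graph n → Subset n → ℕ
edgesIn {n} G S =
  sum (map (λ u → sum (map (λ v →
     if lookup S u ∧ lookup S v ∧ adj G u v ∧ (toℕ u <ᵇ toℕ v) then 1 else 0)
     (allFin n))) (allFin n))

ℕ→ℚ : ℕ → ℚ
ℕ→ℚ k = + k ℚ./ 1

-- minimum of f over i ∈ Fin r; only used with r ≥ 1 (value 0 for r = 0 is irrelevant)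
minFin : (r : ℕ) → (Fin r → ℚ) → ℚ
minFin zero f = 0ℚ
minFin (suc zero) f = f Fin.zero
  where import Data.Fin as Fin
minFin (suc (suc r)) f = f Fin.zero ⊓ minFin (suc r) (λ i → f (Fin.suc i))
  where import Data.Fin as Fin

-- density d(S,G) = m(S,G)/|S|; only used for nonempty S (value 0 for |S| = 0 is irrelevant)
ratio : ℕ → ℕ → ℚ
ratio m zero = 0ℚ
ratio m (suc k) = + m ℚ./ suc k

density : ∀ {n} → Graph n → Subset n → ℚ
density G S = ratio (edgesIn G S) ∣ S ∣

score : ∀ {n r} → (Fin r → Graph n) → Subset n → ℚ
score {r = r} Gs S = minFin r (λ i → density (Gs i) S)

IsOptimalMDSValue : ∀ {n r} → (Fin r → Graph n) → ℚ → Set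
IsOptimalMDSValue Gs γ* =
  (∃ λ S → Nonempty S × score Gs S ≡ γ*) × (∀ T → Nonempty T → score Gs T ≤ γ*)

mdsObj : ∀ {n r} → (Fin r → Graph n) → ℚ → Subset n → ℚ
mdsObj {r = r} Gs γ S = minFin r (λ i → ℕ→ℚ (edgesIn (Gs i) S)) - γ * ℕ→ℚ ∣ S ∣

IsOptimalMDSγ : ∀ {n r} → (Fin r → Graph n) → ℚ → Subset n → Set
IsOptimalMDSγ Gs γ S = ∀ T → mdsObj Gs γ T ≤ mdsObj Gs γ S

ExactSolver : ∀ {n r} → (Fin r → Graph n) → (ℚ → Subset n) → Set
ExactSolver Gs sol = ∀ γ → IsOptimalMDSγ Gs γ (sol γ)

initState : ℕ → ℚ × ℚ
initState n = 0ℚ , (+ (n ∸ 1) ℚ./ 2)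

step : ∀ {n} → (ℚ → Subset n) → ℚ × ℚ → ℚ × ℚ
step sol (L , U) =
  let γ = (L + U) * ½ in
  if does (nonempty? (sol γ)) then (γ , U) else (L , γ)

run : ∀ {n} → (ℚ → Subset n) → ℕ → ℚ × ℚ
run {n} sol zero = initState n
run sol (suc k) = step sol (run sol k)

Stop : ℚ → ℚ × ℚ → Set
Stop ε (L , U) = absℚ (U - L) ≤ ε * L

StopsAt : ∀ {n} → (ℚ → Subset n) → ℚ → ℕ → Set
StopsAt sol ε k = Stop ε (run sol k) × (∀ j → j ℕ.< k → (Stop ε (run sol j) → Data.Empty.⊥))
  where import Data.Empty

output : ∀ {n} → (ℚ → Subset n) → ℕ → Subset n
output sol k = sol (proj₁ (run sol k))

{-# OPTIONS --safe #-}

-- Comparing an optimum of MDS(γ) with the empty set (objective 0) shows: a nonempty optimum S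
-- has score ≥ γ, and an empty optimum means every nonempty set has score ≤ γ.  So the binary
-- search keeps U ≥ γ* and L either 0 or certified by a nonempty optimum; when it stops,
-- γ* ≤ U ≤ (1 + ε) L ≤ (1 + ε) γ.  For n ≥ 2 the case L = 0 is excluded because U stays
-- positive.  Scores are fractions a / s with a < n² and s ≤ n, so two different scores differ
-- by a factor of more than 1 + 1 / n³; hence ε ≤ 1 / n³ forces γ = γ*.

module Submission where

open import Defs
open import Data.Nat using (ℕ; _≤_; _^_)
open import Data.Fin using (Fin)
open import Data.Fin.Subset using (Subset; Nonempty)
open import Data.Rational using (ℚ; 0ℚ; 1ℚ; _<_; _+_; _*_) renaming (_≤_ to _≤ℚ_)
open import Data.Product using (_×_)
open import Relation.Binary.PropositionalEquality using (_≡_)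

open import Data.Bool using (Bool; true; false; if_then_else_; _∧_)
open import Data.Nat as ℕ using (zero; suc; z≤n; s≤s; _∸_; _<ᵇ_)
import Data.Nat.Properties as ℕ
import Data.Nat.Tactic.RingSolver as ℕ-Solver
import Data.Nat.Coprimality as Coprime
open import Data.Nat.ListAction using (sum)
open import Data.Integer as ℤ using (+_)
import Data.Integer.Properties as ℤ
import Data.Integer.Tactic.RingSolver as ℤ-Solver
open import Data.Rational
  using (mkℚ; toℚᵘ; -_; _-_; _⊓_; ½; *≤*; *<*; Positive; NonNegative; positive; nonNegative)
  renaming (∣_∣ to absℚ)
open import Data.Rational.Properties
open import Data.Rational.Solver using (module +-*-Solver)
open import Data.Rational.Unnormalised as ℚᵘ using (mkℚᵘ; *≡*) renaming (_≃_ to _≃ᵘ_)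
import Data.Rational.Unnormalised.Properties as ℚᵘ
open import Data.Fin as Fin using (toℕ)
open import Data.Fin.Subset using (∣_∣; ⊥)
open import Data.Fin.Subset.Properties using (Empty-unique; ∣⊥∣≡0; ∣p∣≤n; x∈p⇒∣p-x∣<∣p∣; nonempty?)
open import Data.List using (map; allFin)
open import Data.List.Properties using (map-tabulate)
open import Data.Vec using (lookup; _∷_; [])
open import Data.Product using (∃; _,_; proj₁; proj₂; uncurry)
open import Data.Sum using (_⊎_; inj₁; inj₂; [_,_]′)
import Data.Empty
open import Function using (_∘_; id)
open import Relation.Nullary using (¬_; Dec; does; yes; no)
open import Relation.Binary.PropositionalEquality
  using (refl; trans; cong; cong₂; subst; subst₂; module ≡-Reasoning)
import Relation.Binary.PropositionalEquality as ≡

open +-*-Solver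

ℕ→ℚ≡mkℚ : ∀ k → ℕ→ℚ k ≡ mkℚ (+ k) 0 (Coprime.sym (Coprime.1-coprimeTo k))
ℕ→ℚ≡mkℚ k = normalize-coprime _

toℚᵘ-ratio : ∀ m k → toℚᵘ (ratio m (suc k)) ≃ᵘ mkℚᵘ (+ m) k
toℚᵘ-ratio m k = toℚᵘ-fromℚᵘ (mkℚᵘ (+ m) k)

ℕ→ℚ-+ : ∀ a b → ℕ→ℚ (a ℕ.+ b) ≡ ℕ→ℚ a + ℕ→ℚ b
ℕ→ℚ-+ a b = toℚᵘ-injective (begin
  toℚᵘ (ℕ→ℚ (a ℕ.+ b))              ≈⟨ toℚᵘ-ratio (a ℕ.+ b) 0 ⟩
  mkℚᵘ (+ (a ℕ.+ b)) 0              ≈⟨ *≡* (trans (cong (ℤ._* + 1) (ℤ.pos-+ a b)) (sum-identity (+ a) (+ b))) ⟩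
  mkℚᵘ (+ a) 0 ℚᵘ.+ mkℚᵘ (+ b) 0    ≈⟨ ℚᵘ.+-cong (ℚᵘ.≃-sym (toℚᵘ-ratio a 0)) (ℚᵘ.≃-sym (toℚᵘ-ratio b 0)) ⟩
  toℚᵘ (ℕ→ℚ a) ℚᵘ.+ toℚᵘ (ℕ→ℚ b)    ≈⟨ ℚᵘ.≃-sym (toℚᵘ-homo-+ (ℕ→ℚ a) (ℕ→ℚ b)) ⟩
  toℚᵘ (ℕ→ℚ a + ℕ→ℚ b)              ∎)
  where
  open ℚᵘ.≃-Reasoning
  sum-identity : ∀ x y → (x ℤ.+ y) ℤ.* (+ 1 ℤ.* + 1) ≡ (x ℤ.* + 1 ℤ.+ y ℤ.* + 1) ℤ.* + 1
  sum-identity = ℤ-Solver.solve-∀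

ℕ→ℚ-* : ∀ a b → ℕ→ℚ (a ℕ.* b) ≡ ℕ→ℚ a * ℕ→ℚ b
ℕ→ℚ-* a b = toℚᵘ-injective (begin
  toℚᵘ (ℕ→ℚ (a ℕ.* b))              ≈⟨ toℚᵘ-ratio (a ℕ.* b) 0 ⟩
  mkℚᵘ (+ (a ℕ.* b)) 0              ≈⟨ *≡* (trans (cong (ℤ._* + 1) (ℤ.pos-* a b)) (product-identity (+ a) (+ b))) ⟩
  mkℚᵘ (+ a) 0 ℚᵘ.* mkℚᵘ (+ b) 0    ≈⟨ ℚᵘ.*-cong (ℚᵘ.≃-sym (toℚᵘ-ratio a 0)) (ℚᵘ.≃-sym (toℚᵘ-ratio b 0)) ⟩
  toℚᵘ (ℕ→ℚ a) ℚᵘ.* toℚᵘ (ℕ→ℚ b)    ≈⟨ ℚᵘ.≃-sym (toℚᵘ-homo-* (ℕ→ℚ a) (ℕ→ℚ b)) ⟩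
  toℚᵘ (ℕ→ℚ a * ℕ→ℚ b)              ∎)
  where
  open ℚᵘ.≃-Reasoning
  product-identity : ∀ x y → (x ℤ.* y) ℤ.* (+ 1 ℤ.* + 1) ≡ (x ℤ.* y) ℤ.* + 1
  product-identity = ℤ-Solver.solve-∀

ratio-*-cancel : ∀ m t → 0 ℕ.< t → ratio m t * ℕ→ℚ t ≡ ℕ→ℚ m
ratio-*-cancel m (suc k) _ = toℚᵘ-injective (begin
  toℚᵘ (ratio m (suc k) * ℕ→ℚ (suc k))            ≈⟨ toℚᵘ-homo-* (ratio m (suc k)) (ℕ→ℚ (suc k)) ⟩
  toℚᵘ (ratio m (suc k)) ℚᵘ.* toℚᵘ (ℕ→ℚ (suc k))  ≈⟨ ℚᵘ.*-cong (toℚᵘ-ratio m k) (toℚᵘ-ratio (suc k) 0) ⟩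
  mkℚᵘ (+ m) k ℚᵘ.* mkℚᵘ (+ suc k) 0              ≈⟨ *≡* (cancel-identity (+ m) (+ suc k)) ⟩
  mkℚᵘ (+ m) 0                                    ≈⟨ ℚᵘ.≃-sym (toℚᵘ-ratio m 0) ⟩
  toℚᵘ (ℕ→ℚ m)                                    ∎)
  where
  open ℚᵘ.≃-Reasoning
  cancel-identity : ∀ x y → (x ℤ.* y) ℤ.* + 1 ≡ x ℤ.* (y ℤ.* + 1)
  cancel-identity = ℤ-Solver.solve-∀

ℕ→ℚ-mono-≤ : ∀ {a b} → a ≤ b → ℕ→ℚ a ≤ℚ ℕ→ℚ b
ℕ→ℚ-mono-≤ {a} {b} a≤b rewrite ℕ→ℚ≡mkℚ a | ℕ→ℚ≡mkℚ b =
  *≤* (subst₂ ℤ._≤_ (≡.sym (ℤ.*-identityʳ (+ a))) (≡.sym (ℤ.*-identityʳ (+ b))) (ℤ.+≤+ a≤b))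

ℕ→ℚ-mono-< : ∀ {a b} → a ℕ.< b → ℕ→ℚ a < ℕ→ℚ b
ℕ→ℚ-mono-< {a} {b} a<b rewrite ℕ→ℚ≡mkℚ a | ℕ→ℚ≡mkℚ b =
  *<* (subst₂ ℤ._<_ (≡.sym (ℤ.*-identityʳ (+ a))) (≡.sym (ℤ.*-identityʳ (+ b))) (ℤ.+<+ a<b))

ℕ→ℚ-cancel-< : ∀ {a b} → ℕ→ℚ a < ℕ→ℚ b → a ℕ.< b
ℕ→ℚ-cancel-< {a} {b} lt = ℕ.≰⇒> (λ b≤a → <-irrefl refl (<-≤-trans lt (ℕ→ℚ-mono-≤ b≤a)))

ℕ→ℚ-<⇒1+≤ : ∀ {a b} → ℕ→ℚ a < ℕ→ℚ b → 1ℚ + ℕ→ℚ a ≤ℚ ℕ→ℚ b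
ℕ→ℚ-<⇒1+≤ {a} {b} lt = subst (_≤ℚ ℕ→ℚ b) (ℕ→ℚ-+ 1 a) (ℕ→ℚ-mono-≤ (ℕ→ℚ-cancel-< {a} {b} lt))

ℕ→ℚ-nonNeg : ∀ k → NonNegative (ℕ→ℚ k)
ℕ→ℚ-nonNeg k = nonNegative (ℕ→ℚ-mono-≤ (z≤n {k}))

ℕ→ℚ-pos : ∀ {k} → 0 ℕ.< k → Positive (ℕ→ℚ k)
ℕ→ℚ-pos 0<k = positive (ℕ→ℚ-mono-< 0<k)

scale-fraction : ∀ x a s t → x * ℕ→ℚ s ≡ ℕ→ℚ a → x * ℕ→ℚ (s ℕ.* t) ≡ ℕ→ℚ (a ℕ.* t)
scale-fraction x a s t xs≡a = begin
  x * ℕ→ℚ (s ℕ.* t)       ≡⟨ cong (x *_) (ℕ→ℚ-* s t) ⟩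
  x * (ℕ→ℚ s * ℕ→ℚ t)     ≡⟨ *-assoc x (ℕ→ℚ s) (ℕ→ℚ t) ⟨
  x * ℕ→ℚ s * ℕ→ℚ t       ≡⟨ cong (_* ℕ→ℚ t) xs≡a ⟩
  ℕ→ℚ a * ℕ→ℚ t           ≡⟨ ℕ→ℚ-* a t ⟨
  ℕ→ℚ (a ℕ.* t)           ∎
  where open ≡-Reasoning

ratio-mono : ∀ {a b s t} → 0 ℕ.< s → 0 ℕ.< t → a ℕ.* t ≤ b ℕ.* s → ratio a s ≤ℚ ratio b t
ratio-mono {a} {b} {s} {t} s>0 t>0 at≤bs =
  *-cancelʳ-≤-pos (ℕ→ℚ (s ℕ.* t)) {{ℕ→ℚ-pos (ℕ.*-mono-< s>0 t>0)}} (begin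
    ratio a s * ℕ→ℚ (s ℕ.* t)   ≡⟨ scale-fraction (ratio a s) a s t (ratio-*-cancel a s s>0) ⟩
    ℕ→ℚ (a ℕ.* t)               ≤⟨ ℕ→ℚ-mono-≤ at≤bs ⟩
    ℕ→ℚ (b ℕ.* s)               ≡⟨ scale-fraction (ratio b t) b t s (ratio-*-cancel b t t>0) ⟨
    ratio b t * ℕ→ℚ (t ℕ.* s)   ≡⟨ cong (λ k → ratio b t * ℕ→ℚ k) (ℕ.*-comm t s) ⟩
    ratio b t * ℕ→ℚ (s ℕ.* t)   ∎)
  where open ≤-Reasoning

-- Cross-multiplying gives a t < b s ≤ (1 + ε) a t in ℕ, so the gap b s - a t is at least 1.
fraction-gap : ∀ {x y ε a b s t} → 0 ℕ.< s → 0 ℕ.< t →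
               x * ℕ→ℚ s ≡ ℕ→ℚ a → y * ℕ→ℚ t ≡ ℕ→ℚ b →
               x < y → y ≤ℚ (1ℚ + ε) * x → 1ℚ ≤ℚ ε * ℕ→ℚ (a ℕ.* t)
fraction-gap {x} {y} {ε} {a} {b} {s} {t} s>0 t>0 xs≡a yt≡b x<y y≤[1+ε]x = begin
  1ℚ                  ≡⟨ solve 1 (λ A → con 1ℚ := (con 1ℚ :+ A) :- A) refl A ⟩
  (1ℚ + A) - A        ≤⟨ +-monoˡ-≤ (- A) (≤-trans (ℕ→ℚ-<⇒1+≤ {a ℕ.* t} {b ℕ.* s} A<B) B≤[1+ε]A) ⟩
  (1ℚ + ε) * A - A    ≡⟨ solve 2 (λ e A → (con 1ℚ :+ e) :* A :- A := e :* A) refl ε A ⟩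
  ε * A               ∎
  where
  open ≤-Reasoning
  A = ℕ→ℚ (a ℕ.* t)
  B = ℕ→ℚ (b ℕ.* s)
  M = ℕ→ℚ (s ℕ.* t)
  instance
    M-pos : Positive M
    M-pos = ℕ→ℚ-pos (ℕ.*-mono-< s>0 t>0)
  xM≡A : x * M ≡ A
  xM≡A = scale-fraction x a s t xs≡a
  yM≡B : y * M ≡ B
  yM≡B = trans (cong (λ k → y * ℕ→ℚ k) (ℕ.*-comm s t)) (scale-fraction y b t s yt≡b)
  A<B : A < B
  A<B = subst₂ _<_ xM≡A yM≡B (*-monoˡ-<-pos M x<y)
  B≤[1+ε]A : B ≤ℚ (1ℚ + ε) * A
  B≤[1+ε]A = begin
    B                     ≡⟨ yM≡B ⟨
    y * M                 ≤⟨ *-monoʳ-≤-nonNeg M {{pos⇒nonNeg M}} y≤[1+ε]x ⟩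
    (1ℚ + ε) * x * M      ≡⟨ *-assoc (1ℚ + ε) x M ⟩
    (1ℚ + ε) * (x * M)    ≡⟨ cong ((1ℚ + ε) *_) xM≡A ⟩
    (1ℚ + ε) * A          ∎

sumFin : (n : ℕ) → (Fin n → ℕ) → ℕ
sumFin n f = sum (map f (allFin n))

sumFin-suc : ∀ n (f : Fin (suc n) → ℕ) → sumFin (suc n) f ≡ f Fin.zero ℕ.+ sumFin n (f ∘ Fin.suc)
sumFin-suc n f = cong (λ l → f Fin.zero ℕ.+ sum l)
  (trans (map-tabulate Fin.suc f) (≡.sym (map-tabulate id (f ∘ Fin.suc))))

sumFin-mono : ∀ n {f g : Fin n → ℕ} → (∀ i → f i ℕ.≤ g i) → sumFin n f ℕ.≤ sumFin n g
sumFin-mono zero f≤g = z≤n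
sumFin-mono (suc n) {f} {g} f≤g rewrite sumFin-suc n f | sumFin-suc n g =
  ℕ.+-mono-≤ (f≤g Fin.zero) (sumFin-mono n (f≤g ∘ Fin.suc))

sumFin-cong : ∀ n {f g : Fin n → ℕ} → (∀ i → f i ≡ g i) → sumFin n f ≡ sumFin n g
sumFin-cong zero f≗g = refl
sumFin-cong (suc n) {f} {g} f≗g rewrite sumFin-suc n f | sumFin-suc n g =
  cong₂ ℕ._+_ (f≗g Fin.zero) (sumFin-cong n (f≗g ∘ Fin.suc))

sumFin-0 : ∀ n → sumFin n (λ _ → 0) ≡ 0
sumFin-0 zero    = refl
sumFin-0 (suc n) = trans (sumFin-suc n (λ _ → 0)) (sumFin-0 n)

indicator : Bool → ℕ
indicator b = if b then 1 else 0

sumFin-indicator : ∀ {n} (S : Subset n) → sumFin n (indicator ∘ lookup S) ≡ ∣ S ∣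
sumFin-indicator [] = refl
sumFin-indicator {suc n} (x ∷ S) rewrite sumFin-suc n (indicator ∘ lookup (x ∷ S)) with x
... | true = cong suc (sumFin-indicator S)
... | false = sumFin-indicator S

pairsIn : ∀ {n} → Subset n → ℕ
pairsIn {n} S = sumFin n (λ u → sumFin n (λ v → indicator (lookup S u ∧ lookup S v ∧ (toℕ u <ᵇ toℕ v))))

edgesIn≤pairsIn : ∀ {n} (G : Graph n) S → edgesIn G S ℕ.≤ pairsIn S
edgesIn≤pairsIn {n} G S = sumFin-mono n (λ u → sumFin-mono n (λ v →
  drop-adj (lookup S u) (lookup S v) (adj G u v) (toℕ u <ᵇ toℕ v)))
  where
  drop-adj : ∀ a b c d → indicator (a ∧ b ∧ c ∧ d) ℕ.≤ indicator (a ∧ b ∧ d)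
  drop-adj false b c d = z≤n
  drop-adj true false c d = z≤n
  drop-adj true true false d = z≤n
  drop-adj true true true d = ℕ.≤-refl

pairsIn-∷ : ∀ {n} x (S : Subset n) → pairsIn (x ∷ S) ≡ (if x then ∣ S ∣ else 0) ℕ.+ pairsIn S
pairsIn-∷ {n} x S = trans (sumFin-suc n _) (cong₂ ℕ._+_ (first-row x) later-rows)
  where
  ∧-false : ∀ a b → indicator (a ∧ b ∧ false) ≡ 0
  ∧-false false b = refl
  ∧-false true false = refl
  ∧-false true true = refl

  ∧-true : ∀ a → indicator (a ∧ true) ≡ indicator a
  ∧-true false = refl
  ∧-true true = refl

  first-row : ∀ x → sumFin (suc n) (λ v → indicator (x ∧ lookup (x ∷ S) v ∧ (0 <ᵇ toℕ v)))
                    ≡ (if x then ∣ S ∣ else 0)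
  first-row false = sumFin-0 (suc n)
  first-row true = begin
    sumFin (suc n) (λ v → indicator (lookup (true ∷ S) v ∧ (0 <ᵇ toℕ v)))
      ≡⟨ sumFin-suc n (λ v → indicator (lookup (true ∷ S) v ∧ (0 <ᵇ toℕ v))) ⟩
    sumFin n (λ v → indicator (lookup S v ∧ true))
      ≡⟨ sumFin-cong n (∧-true ∘ lookup S) ⟩
    sumFin n (indicator ∘ lookup S)
      ≡⟨ sumFin-indicator S ⟩
    ∣ S ∣ ∎
    where open ≡-Reasoning

  row : Fin n → ℕ
  row u = sumFin n (λ v → indicator (lookup S u ∧ lookup S v ∧ (toℕ u <ᵇ toℕ v)))

  later-rows : sumFin n (λ u → sumFin (suc n) (λ v →
                 indicator (lookup S u ∧ lookup (x ∷ S) v ∧ (suc (toℕ u) <ᵇ toℕ v))))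
               ≡ pairsIn S
  later-rows = sumFin-cong n (λ u →
    trans (sumFin-suc n _) (cong (ℕ._+ row u) (∧-false (lookup S u) x)))

2*pairsIn+∣S∣≡∣S∣² : ∀ {n} (S : Subset n) → 2 ℕ.* pairsIn S ℕ.+ ∣ S ∣ ≡ ∣ S ∣ ℕ.* ∣ S ∣
2*pairsIn+∣S∣≡∣S∣² [] = refl
2*pairsIn+∣S∣≡∣S∣² (x ∷ S) rewrite pairsIn-∷ x S with x
... | false = 2*pairsIn+∣S∣≡∣S∣² S
... | true = trans (shuffle ∣ S ∣ (pairsIn S))
                   (trans (cong (ℕ._+ (2 ℕ.* ∣ S ∣ ℕ.+ 1)) (2*pairsIn+∣S∣≡∣S∣² S)) (≡.sym (square-suc ∣ S ∣)))
  where
  shuffle : ∀ s p → 2 ℕ.* (s ℕ.+ p) ℕ.+ suc s ≡ (2 ℕ.* p ℕ.+ s) ℕ.+ (2 ℕ.* s ℕ.+ 1)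
  shuffle = ℕ-Solver.solve-∀
  square-suc : ∀ s → suc s ℕ.* suc s ≡ s ℕ.* s ℕ.+ (2 ℕ.* s ℕ.+ 1)
  square-suc = ℕ-Solver.solve-∀

2*edgesIn+∣S∣≤∣S∣² : ∀ {n} (G : Graph n) S → 2 ℕ.* edgesIn G S ℕ.+ ∣ S ∣ ℕ.≤ ∣ S ∣ ℕ.* ∣ S ∣
2*edgesIn+∣S∣≤∣S∣² G S = ℕ.≤-trans (ℕ.+-monoˡ-≤ ∣ S ∣ (ℕ.*-monoʳ-≤ 2 (edgesIn≤pairsIn G S)))
                              (ℕ.≤-reflexive (2*pairsIn+∣S∣≡∣S∣² S))

nonempty⇒∣p∣>0 : ∀ {n} {p : Subset n} → Nonempty p → 0 ℕ.< ∣ p ∣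
nonempty⇒∣p∣>0 (_ , x∈p) = ℕ.≤-<-trans z≤n (x∈p⇒∣p-x∣<∣p∣ x∈p)

empty⇒∣p∣≡0 : ∀ {n} {p : Subset n} → ¬ Nonempty p → ∣ p ∣ ≡ 0
empty⇒∣p∣≡0 {n} ¬ne = trans (cong ∣_∣ (Empty-unique ¬ne)) (∣⊥∣≡0 n)

∣S∣≡0⇒edgesIn≡0 : ∀ {n} (G : Graph n) S → ∣ S ∣ ≡ 0 → edgesIn G S ≡ 0
∣S∣≡0⇒edgesIn≡0 G S ∣S∣≡0 =
  ℕ.m+n≡0⇒m≡0 _ (ℕ.m+n≡0⇒m≡0 (2 ℕ.* edgesIn G S) (ℕ.n≤0⇒n≡0 bound))
  where
  bound : 2 ℕ.* edgesIn G S ℕ.+ 0 ≤ 0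
  bound = subst (λ s → 2 ℕ.* edgesIn G S ℕ.+ s ≤ s ℕ.* s) ∣S∣≡0 (2*edgesIn+∣S∣≤∣S∣² G S)

a<n²⇒a*t<n³ : ∀ {a t n} → a ℕ.< n ℕ.* n → 0 ℕ.< t → t ≤ n → a ℕ.* t ℕ.< n ^ 3
a<n²⇒a*t<n³ {a} {t} {n} a<n² t>0 t≤n = begin-strict
  a ℕ.* t               <⟨ ℕ.*-monoˡ-< t {{ℕ.>-nonZero t>0}} a<n² ⟩
  n ℕ.* n ℕ.* t         ≤⟨ ℕ.*-monoʳ-≤ (n ℕ.* n) t≤n ⟩
  n ℕ.* n ℕ.* n         ≡⟨ cube n ⟩
  n ^ 3                 ∎
  where
  open ℕ.≤-Reasoning
  cube : ∀ n → n ℕ.* n ℕ.* n ≡ n ℕ.* (n ℕ.* (n ℕ.* 1))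
  cube = ℕ-Solver.solve-∀

edgesIn<n² : ∀ {n} (G : Graph n) S → Nonempty S → edgesIn G S ℕ.< n ℕ.* n
edgesIn<n² {n} G S ne = begin-strict
  m                   ≤⟨ ℕ.m≤m+n m (m ℕ.+ 0) ⟩
  2 ℕ.* m             <⟨ ℕ.m<m+n (2 ℕ.* m) (nonempty⇒∣p∣>0 ne) ⟩
  2 ℕ.* m ℕ.+ ∣ S ∣   ≤⟨ 2*edgesIn+∣S∣≤∣S∣² G S ⟩
  ∣ S ∣ ℕ.* ∣ S ∣     ≤⟨ ℕ.*-mono-≤ (∣p∣≤n S) (∣p∣≤n S) ⟩
  n ℕ.* n             ∎
  where
  open ℕ.≤-Reasoning
  m = edgesIn G S

2*edgesIn≤[n∸1]*∣S∣ : ∀ {n} (G : Graph n) S → edgesIn G S ℕ.* 2 ≤ (n ∸ 1) ℕ.* ∣ S ∣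
2*edgesIn≤[n∸1]*∣S∣ {n} G S = begin
  m ℕ.* 2             ≡⟨ ℕ.*-comm m 2 ⟩
  2 ℕ.* m             ≤⟨ ℕ.m+n≤o⇒m≤o∸n (2 ℕ.* m) (2*edgesIn+∣S∣≤∣S∣² G S) ⟩
  s ℕ.* s ∸ s         ≡⟨ cong (s ℕ.* s ∸_) (ℕ.*-identityʳ s) ⟨
  s ℕ.* s ∸ s ℕ.* 1   ≡⟨ ℕ.*-distribˡ-∸ s s 1 ⟨
  s ℕ.* (s ∸ 1)       ≤⟨ ℕ.*-monoʳ-≤ s (ℕ.∸-monoˡ-≤ 1 (∣p∣≤n S)) ⟩
  s ℕ.* (n ∸ 1)       ≡⟨ ℕ.*-comm s (n ∸ 1) ⟩
  (n ∸ 1) ℕ.* s       ∎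
  where
  open ℕ.≤-Reasoning
  m = edgesIn G S
  s = ∣ S ∣

minFin-≤ : ∀ r f (i : Fin r) → minFin r f ≤ℚ f i
minFin-≤ (suc zero)    f Fin.zero    = ≤-refl
minFin-≤ (suc (suc r)) f Fin.zero    = p⊓q≤p (f Fin.zero) _
minFin-≤ (suc (suc r)) f (Fin.suc i) = ≤-trans (p⊓q≤q (f Fin.zero) _) (minFin-≤ (suc r) (λ i → f (Fin.suc i)) i)

minFin-attained : ∀ r f → ∃ λ (j : Fin (suc r)) → minFin (suc r) f ≡ f j
minFin-attained zero    f = Fin.zero , refl
minFin-attained (suc r) f with ≤-total (f Fin.zero) (minFin (suc r) (λ i → f (Fin.suc i)))
... | inj₁ f₀≤ = Fin.zero , p≤q⇒p⊓q≡p f₀≤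
... | inj₂ f₀≥ with minFin-attained r (λ i → f (Fin.suc i))
...   | j , eq = Fin.suc j , trans (p≥q⇒p⊓q≡q f₀≥) eq

minFin-*-nonNeg : ∀ r f c .{{_ : NonNegative c}} → minFin r f * c ≡ minFin r (λ i → f i * c)
minFin-*-nonNeg zero          f c = *-zeroˡ c
minFin-*-nonNeg (suc zero)    f c = refl
minFin-*-nonNeg (suc (suc r)) f c = trans (*-distribʳ-⊓-nonNeg c (f Fin.zero) _)
  (cong (f Fin.zero * c ⊓_) (minFin-*-nonNeg (suc r) (λ i → f (Fin.suc i)) c))

minFin-cong : ∀ r {f g : Fin r → ℚ} → (∀ i → f i ≡ g i) → minFin r f ≡ minFin r g
minFin-cong zero          f≗g = refl
minFin-cong (suc zero)    f≗g = f≗g Fin.zero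
minFin-cong (suc (suc r)) f≗g = cong₂ _⊓_ (f≗g Fin.zero) (minFin-cong (suc r) (f≗g ∘ Fin.suc))

module _ {n r} (Gs : Fin r → Graph n) where

  score*∣S∣≡min-edgesIn : ∀ S → Nonempty S →
                 score Gs S * ℕ→ℚ ∣ S ∣ ≡ minFin r (λ i → ℕ→ℚ (edgesIn (Gs i) S))
  score*∣S∣≡min-edgesIn S ne = trans (minFin-*-nonNeg r _ (ℕ→ℚ ∣ S ∣) {{ℕ→ℚ-nonNeg ∣ S ∣}})
    (minFin-cong r (λ i → ratio-*-cancel (edgesIn (Gs i) S) ∣ S ∣ (nonempty⇒∣p∣>0 ne)))

  mdsObj+γ∣S∣≡score*∣S∣ : ∀ γ S → Nonempty S →
                    mdsObj Gs γ S + γ * ℕ→ℚ ∣ S ∣ ≡ score Gs S * ℕ→ℚ ∣ S ∣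
  mdsObj+γ∣S∣≡score*∣S∣ γ S ne = trans
    (solve 2 (λ m g → (m :- g) :+ g := m) refl (minFin r (λ i → ℕ→ℚ (edgesIn (Gs i) S))) (γ * ℕ→ℚ ∣ S ∣))
    (≡.sym (score*∣S∣≡min-edgesIn S ne))

module _ {n r} (Gs : Fin (suc r) → Graph n) where

  ∣S∣≡0⇒mdsObj≡0 : ∀ γ S → ∣ S ∣ ≡ 0 → mdsObj Gs γ S ≡ 0ℚ
  ∣S∣≡0⇒mdsObj≡0 γ S ∣S∣≡0 = begin
    minFin (suc r) (λ i → ℕ→ℚ (edgesIn (Gs i) S)) - γ * ℕ→ℚ ∣ S ∣
      ≡⟨ cong₂ (λ m s → m - γ * ℕ→ℚ s) min-edges≡0 ∣S∣≡0 ⟩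
    0ℚ - γ * 0ℚ
      ≡⟨ cong (λ x → 0ℚ - x) (*-zeroʳ γ) ⟩
    0ℚ - 0ℚ
      ≡⟨ +-inverseʳ 0ℚ ⟩
    0ℚ ∎
    where
    open ≡-Reasoning
    min-edges≡0 : minFin (suc r) (λ i → ℕ→ℚ (edgesIn (Gs i) S)) ≡ 0ℚ
    min-edges≡0 =
      let j , min≡ = minFin-attained r (λ i → ℕ→ℚ (edgesIn (Gs i) S))
      in trans min≡ (cong ℕ→ℚ (∣S∣≡0⇒edgesIn≡0 (Gs j) S ∣S∣≡0))

  nonempty-optimum⇒≤score : ∀ {γ S} → IsOptimalMDSγ Gs γ S → Nonempty S → γ ≤ℚ score Gs S
  nonempty-optimum⇒≤score {γ} {S} optimal ne =
    *-cancelʳ-≤-pos (ℕ→ℚ ∣ S ∣) {{ℕ→ℚ-pos (nonempty⇒∣p∣>0 ne)}} (begin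
      γ * ℕ→ℚ ∣ S ∣                   ≡⟨ +-identityˡ _ ⟨
      0ℚ + γ * ℕ→ℚ ∣ S ∣              ≡⟨ cong (_+ γ * ℕ→ℚ ∣ S ∣) (∣S∣≡0⇒mdsObj≡0 γ ⊥ (∣⊥∣≡0 n)) ⟨
      mdsObj Gs γ ⊥ + γ * ℕ→ℚ ∣ S ∣   ≤⟨ +-monoˡ-≤ (γ * ℕ→ℚ ∣ S ∣) (optimal ⊥) ⟩
      mdsObj Gs γ S + γ * ℕ→ℚ ∣ S ∣   ≡⟨ mdsObj+γ∣S∣≡score*∣S∣ Gs γ S ne ⟩
      score Gs S * ℕ→ℚ ∣ S ∣          ∎)
    where open ≤-Reasoning

  empty-optimum⇒score≤ : ∀ {γ S} → IsOptimalMDSγ Gs γ S → ¬ Nonempty S →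
                         ∀ T → Nonempty T → score Gs T ≤ℚ γ
  empty-optimum⇒score≤ {γ} {S} optimal ¬ne T ne =
    *-cancelʳ-≤-pos (ℕ→ℚ ∣ T ∣) {{ℕ→ℚ-pos (nonempty⇒∣p∣>0 ne)}} (begin
      score Gs T * ℕ→ℚ ∣ T ∣          ≡⟨ mdsObj+γ∣S∣≡score*∣S∣ Gs γ T ne ⟨
      mdsObj Gs γ T + γ * ℕ→ℚ ∣ T ∣   ≤⟨ +-monoˡ-≤ (γ * ℕ→ℚ ∣ T ∣) (optimal T) ⟩
      mdsObj Gs γ S + γ * ℕ→ℚ ∣ T ∣   ≡⟨ cong (_+ γ * ℕ→ℚ ∣ T ∣) (∣S∣≡0⇒mdsObj≡0 γ S (empty⇒∣p∣≡0 ¬ne)) ⟩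
      0ℚ + γ * ℕ→ℚ ∣ T ∣              ≡⟨ +-identityˡ _ ⟩
      γ * ℕ→ℚ ∣ T ∣                   ∎)
    where open ≤-Reasoning

  score≤[n∸1]/2 : ∀ T → Nonempty T → score Gs T ≤ℚ ratio (n ∸ 1) 2
  score≤[n∸1]/2 T ne = ≤-trans (minFin-≤ (suc r) (λ i → density (Gs i) T) Fin.zero)
    (ratio-mono {a = edgesIn (Gs Fin.zero) T} {b = n ∸ 1} (nonempty⇒∣p∣>0 ne) (s≤s z≤n)
      (2*edgesIn≤[n∸1]*∣S∣ (Gs Fin.zero) T))

  score-fraction : ∀ S → Nonempty S →
                   ∃ λ a → a ℕ.< n ℕ.* n × score Gs S * ℕ→ℚ ∣ S ∣ ≡ ℕ→ℚ a
  score-fraction S ne =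
    let j , score≡ = minFin-attained r (λ i → density (Gs i) S)
    in edgesIn (Gs j) S , edgesIn<n² (Gs j) S ne ,
       trans (cong (_* ℕ→ℚ ∣ S ∣) score≡) (ratio-*-cancel (edgesIn (Gs j) S) ∣ S ∣ (nonempty⇒∣p∣>0 ne))

  scores-separated : ∀ {ε} → 0ℚ < ε → ε * ℕ→ℚ (n ^ 3) ≤ℚ 1ℚ → ∀ S T → Nonempty S → Nonempty T →
                     score Gs T ≤ℚ (1ℚ + ε) * score Gs S → score Gs T ≤ℚ score Gs S
  scores-separated {ε} ε>0 εn³≤1 S T S≢∅ T≢∅ T≤[1+ε]S = ≮⇒≥ λ S<T →
    let a , a<n² , Ss≡a = score-fraction S S≢∅
        b , _    , Tt≡b = score-fraction T T≢∅
        t>0 = nonempty⇒∣p∣>0 T≢∅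
    in <-irrefl refl (begin-strict
      1ℚ                      ≤⟨ fraction-gap {ε = ε} {a = a} {b = b} (nonempty⇒∣p∣>0 S≢∅) t>0
                                   Ss≡a Tt≡b S<T T≤[1+ε]S ⟩
      ε * ℕ→ℚ (a ℕ.* ∣ T ∣)   <⟨ *-monoʳ-<-pos ε {{positive ε>0}}
                                   (ℕ→ℚ-mono-< (a<n²⇒a*t<n³ a<n² t>0 (∣p∣≤n T))) ⟩
      ε * ℕ→ℚ (n ^ 3)         ≤⟨ εn³≤1 ⟩
      1ℚ                      ∎)
    where open ≤-Reasoning

p≤∣p∣ : ∀ p → p ≤ℚ absℚ p
p≤∣p∣ p with 0ℚ ≤? p
... | yes 0≤p = ≤-reflexive (≡.sym (0≤p⇒∣p∣≡p 0≤p))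
... | no  0≰p = ≤-trans (<⇒≤ (≰⇒> 0≰p)) (0≤∣p∣ p)

stop⇒U≤[1+ε]L : ∀ ε {L U} → Stop ε (L , U) → U ≤ℚ (1ℚ + ε) * L
stop⇒U≤[1+ε]L ε {L} {U} ∣U-L∣≤εL = begin
  U                 ≡⟨ solve 2 (λ L U → U := (U :- L) :+ L) refl L U ⟩
  (U - L) + L       ≤⟨ +-monoˡ-≤ L (≤-trans (p≤∣p∣ (U - L)) ∣U-L∣≤εL) ⟩
  ε * L + L         ≡⟨ solve 2 (λ e L → e :* L :+ L := (con 1ℚ :+ e) :* L) refl ε L ⟩
  (1ℚ + ε) * L      ∎
  where open ≤-Reasoning

midpoint-nonneg : ∀ {L U} → 0ℚ ≤ℚ L → 0ℚ ≤ℚ U → 0ℚ ≤ℚ (L + U) * ½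
midpoint-nonneg 0≤L 0≤U = *-monoʳ-≤-nonNeg ½ (+-mono-≤ 0≤L 0≤U)

midpoint-pos : ∀ {L U} → 0ℚ ≤ℚ L → 0ℚ < U → 0ℚ < (L + U) * ½
midpoint-pos 0≤L 0<U = *-monoˡ-<-pos ½ (+-mono-≤-< 0≤L 0<U)

module BinarySearch {n r} (Gs : Fin (suc r) → Graph n) {sol : ℚ → Subset n}
                    (exact : ExactSolver Gs sol) where

  record Invariant (L U : ℚ) : Set where
    field
      L-nonneg        : 0ℚ ≤ℚ L
      U-nonneg        : 0ℚ ≤ℚ U
      L-feasible      : L ≡ 0ℚ ⊎ Nonempty (sol L)
      U-bounds-scores : ∀ T → Nonempty T → score Gs T ≤ℚ U
      U-pos           : 2 ≤ n → 0ℚ < U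

  invariant-init : Invariant 0ℚ (ratio (n ∸ 1) 2)
  invariant-init = record
    { L-nonneg        = ≤-refl
    ; U-nonneg        = nonNegative⁻¹ _ {{normalize-nonNeg (n ∸ 1) 2}}
    ; L-feasible      = inj₁ refl
    ; U-bounds-scores = score≤[n∸1]/2 Gs
    ; U-pos           = λ where (s≤s (s≤s {n = m} _)) → positive⁻¹ _ {{normalize-pos (suc m) 2}}
    }

  invariant-step : ∀ {L U} → Invariant L U → uncurry Invariant (step sol (L , U))
  invariant-step {L} {U} inv = by-cases (nonempty? (sol M))
    where
    open Invariant inv
    M = (L + U) * ½
    by-cases : (d : Dec (Nonempty (sol M))) → uncurry Invariant (if does d then (M , U) else (L , M))
    by-cases (yes ne) = record
      { L-nonneg        = midpoint-nonneg L-nonneg U-nonneg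
      ; U-nonneg        = U-nonneg
      ; L-feasible      = inj₂ ne
      ; U-bounds-scores = U-bounds-scores
      ; U-pos           = U-pos
      }
    by-cases (no ¬ne) = record
      { L-nonneg        = L-nonneg
      ; U-nonneg        = midpoint-nonneg L-nonneg U-nonneg
      ; L-feasible      = L-feasible
      ; U-bounds-scores = empty-optimum⇒score≤ Gs (exact M) ¬ne
      ; U-pos           = midpoint-pos L-nonneg ∘ U-pos
      }

  invariant-run : ∀ k → uncurry Invariant (run sol k)
  invariant-run zero    = invariant-init
  invariant-run (suc k) = invariant-step (invariant-run k)

proposition7 : (n r : ℕ) → 1 ≤ n → 1 ≤ r → (Gs : Fin r → Graph n) → (ε : ℚ) → 0ℚ < ε
    → (sol : ℚ → Subset n) → ExactSolver Gs sol
    → (γ* : ℚ) → IsOptimalMDSValue Gs γ*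
    → (k : ℕ) → StopsAt sol ε k
    → (2 ≤ n → Nonempty (output sol k))
      × (Nonempty (output sol k)
         → (γ* ≤ℚ (1ℚ + ε) * score Gs (output sol k))
           × (ε * ℕ→ℚ (n ^ 3) ≤ℚ 1ℚ → score Gs (output sol k) ≡ γ*))
proposition7 n (suc r) _ (s≤s z≤n) Gs ε ε>0 sol exact _ ((S* , S*≢∅ , refl) , maximal) k (stops , _) =
  output-nonempty , λ S≢∅ → approximation S≢∅ , λ εn³≤1 →
    ≤-antisym (maximal _ S≢∅) (scores-separated Gs ε>0 εn³≤1 _ S* S≢∅ S*≢∅ (approximation S≢∅))
  where
  open BinarySearch Gs {sol} exact
  open Invariant (invariant-run k)

  L = proj₁ (run sol k)
  U = proj₂ (run sol k)

  U≤[1+ε]L : U ≤ℚ (1ℚ + ε) * L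
  U≤[1+ε]L = stop⇒U≤[1+ε]L ε stops

  output-nonempty : 2 ≤ n → Nonempty (sol L)
  output-nonempty 2≤n = [ Data.Empty.⊥-elim ∘ L≢0 , id ]′ L-feasible
    where
    open ≤-Reasoning
    L≢0 : ¬ L ≡ 0ℚ
    L≢0 L≡0 = <-irrefl refl (<-≤-trans (U-pos 2≤n) (begin
      U                 ≤⟨ U≤[1+ε]L ⟩
      (1ℚ + ε) * L      ≡⟨ cong ((1ℚ + ε) *_) L≡0 ⟩
      (1ℚ + ε) * 0ℚ     ≡⟨ *-zeroʳ (1ℚ + ε) ⟩
      0ℚ                ∎))

  approximation : Nonempty (sol L) → score Gs S* ≤ℚ (1ℚ + ε) * score Gs (sol L)
  approximation S≢∅ = begin
    score Gs S*                  ≤⟨ U-bounds-scores S* S*≢∅ ⟩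
    U                            ≤⟨ U≤[1+ε]L ⟩
    (1ℚ + ε) * L                 ≤⟨ *-monoˡ-≤-nonNeg (1ℚ + ε) {{1+ε-nonNeg}}
                                      (nonempty-optimum⇒≤score Gs (exact L) S≢∅) ⟩
    (1ℚ + ε) * score Gs (sol L)  ∎
    where
    open ≤-Reasoning
    1+ε-nonNeg : NonNegative (1ℚ + ε)
    1+ε-nonNeg = nonNegative (+-mono-≤ (nonNegative⁻¹ 1ℚ) (<⇒≤ ε>0))
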